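{- Let $G$ be a tournament with $t\ge 2$ vertices. Then there is an edge of $G$ that is contained in at most $(t+1)/4$ cyclic triangles of $G$.
   Context: A tournament is an orientation of a complete graph. A cyclic triangle is a set of three vertices inducing a directed cycle of length $3$. -}

module Defs where

open import Data.Nat using (ℕ)
open import Data.Fin using (Fin)
open import Data.Bool using (Bool; true; false; _∧_; not)
open import Data.List using (List; length; filter)
open import Data.List using (allFin)
open import Data.Product using (_×_)
open import Relation.Binary.PropositionalEquality using (_≡_; _≢_)
open import Relation.Nullary using (¬_)
open import Data.Bool using (T)
open import Relation.Nullary.Decidable using (T?)

Digraph : ℕ → Set
Digraph t = Fin t → Fin t → Bool

record IsTournament {t : ℕ} (A : Digraph t) : Set where
  field
    irreflexive : ∀ u → A u u ≡ false
    orientation : ∀ u v → u ≢ v → not (A u v) ≡ A v u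

IsArc : {t : ℕ} → Digraph t → Fin t → Fin t → Set
IsArc A u v = A u v ≡ true

-- The number of cyclic triangles containing the arc u → v:
-- the cyclic triangles through the edge {u,v} (with u → v) are exactly
-- the sets {u,v,w} with v → w and w → u; each such triangle is
-- determined by its third vertex w.
cyclicTrianglesOn : {t : ℕ} → Digraph t → Fin t → Fin t → ℕ
cyclicTrianglesOn {t} A u v =
  length (filter (λ w → T? (A v w ∧ A w u)) (allFin t))

-- Count ordered triples of vertices. Every two-path u → v → w closes either to a cyclic triple
-- (w → u) or to a transitive one (u → w), and any two out-neighbours of a vertex are joined by an
-- arc in exactly one direction. With d and e the out- and in-degree this gives Σ e d = C + T and
-- Σ d² = 2T + Σ d, where C is three times the number of cyclic triangles. Since d + e = t − 1,
-- eliminating T and bounding 4 e d ≤ (t − 1)² yields 8C ≤ t (t − 1) (t + 1). But C is also the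
-- sum over the t (t − 1) / 2 arcs of the number of cyclic triangles on each arc, so if every arc
-- lay on more than (t + 1) / 4 of them, 8C ≥ t (t − 1) (t + 2).
module Submission where

open import Defs
open import Data.Nat using (ℕ; _≤_; _*_; _+_)
open import Data.Fin using (Fin)
open import Data.Product using (Σ; _×_; ∃₂)

open import Data.Nat using (zero; suc; z≤n; s≤s; NonZero)
open import Data.Nat.Properties
open import Data.Nat.Tactic.RingSolver using (solve-∀)
open import Algebra.Properties.Semiring.Sum +-*-semiring
  using (sum; sum-syntax; sum-cong-≗; ∑-distrib-+; ∑-comm; *-distribˡ-sum; *-distribʳ-sum; sum-remove)
open import Algebra.Properties.CommutativeSemigroup *-commutativeSemigroup using (xy∙z≈xz∙y; x∙yz≈y∙xz)
open import Data.Fin using (zero; suc; punchIn) renaming (_≟_ to _≟ᶠ_)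
open import Data.Fin.Properties using (any?; punchInᵢ≢i)
open import Data.Bool using (Bool; true; false; _∧_; not) renaming (_≟_ to _≟ᵇ_)
open import Data.List using (length; filter; tabulate)
open import Data.Product using (_,_)
open import Relation.Binary.PropositionalEquality
open import Relation.Nullary using (¬_; yes; no; contradiction)
open import Relation.Nullary.Decidable using (T?; _×-dec_)
open import Data.Sum using (inj₁; inj₂)
open import Function using (_∘_; id)

⟦_⟧ : Bool → ℕ
⟦ true ⟧ = 1
⟦ false ⟧ = 0

⟦∧⟧ : ∀ a b → ⟦ a ∧ b ⟧ ≡ ⟦ a ⟧ * ⟦ b ⟧
⟦∧⟧ true  b = sym (+-identityʳ ⟦ b ⟧)
⟦∧⟧ false b = refl

⟦⟧-idem : ∀ b → ⟦ b ⟧ * ⟦ b ⟧ ≡ ⟦ b ⟧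
⟦⟧-idem true  = refl
⟦⟧-idem false = refl

⟦⟧+⟦not⟧ : ∀ b → ⟦ b ⟧ + ⟦ not b ⟧ ≡ 1
⟦⟧+⟦not⟧ true  = refl
⟦⟧+⟦not⟧ false = refl

⟦⟧*⟦not⟧ : ∀ b → ⟦ b ⟧ * ⟦ not b ⟧ ≡ 0
⟦⟧*⟦not⟧ true  = refl
⟦⟧*⟦not⟧ false = refl

length-filter-tabulate : ∀ {a} {X : Set a} {n} (p : X → Bool) (f : Fin n → X) →
  length (filter (λ x → T? (p x)) (tabulate f)) ≡ ∑[ i < n ] ⟦ p (f i) ⟧
length-filter-tabulate {n = zero}  p f = refl
length-filter-tabulate {n = suc n} p f with p (f zero)
... | true  = cong suc (length-filter-tabulate p (f ∘ suc))
... | false = length-filter-tabulate p (f ∘ suc)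

sum-const : ∀ n k → ∑[ i < n ] k ≡ n * k
sum-const zero    k = refl
sum-const (suc n) k = cong (k +_) (sum-const n k)

sum-mono-≤ : ∀ {n} {f g : Fin n → ℕ} → (∀ i → f i ≤ g i) → sum f ≤ sum g
sum-mono-≤ {zero}  f≤g = z≤n
sum-mono-≤ {suc n} f≤g = +-mono-≤ (f≤g zero) (sum-mono-≤ (f≤g ∘ suc))

sum-*-sum : ∀ {m n} (f : Fin m → ℕ) (g : Fin n → ℕ) →
  sum f * sum g ≡ ∑[ i < m ] ∑[ j < n ] (f i * g j)
sum-*-sum f g = trans (*-distribʳ-sum (sum g) f) (sum-cong-≗ λ i → *-distribˡ-sum (f i) g)

∑∑-distrib-+ : ∀ {m n} (f g : Fin m → Fin n → ℕ) →
  ∑[ i < m ] ∑[ j < n ] (f i j + g i j) ≡ ∑[ i < m ] ∑[ j < n ] f i j + ∑[ i < m ] ∑[ j < n ] g i j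
∑∑-distrib-+ f g = trans (sum-cong-≗ λ i → ∑-distrib-+ (f i) (g i)) (∑-distrib-+ (sum ∘ f) (sum ∘ g))

sum-except : ∀ {n} {f g : Fin (suc n) → ℕ} v → (∀ u → u ≢ v → f u ≡ g u) →
  sum f + g v ≡ sum g + f v
sum-except {f = f} {g} v f≡g = begin
  sum f + g v                        ≡⟨ cong (_+ g v) (sum-remove f) ⟩
  f v + sum (f ∘ punchIn v) + g v    ≡⟨ cong (λ r → f v + r + g v) rest ⟩
  f v + sum (g ∘ punchIn v) + g v    ≡⟨ swap-ends (f v) _ (g v) ⟩
  g v + sum (g ∘ punchIn v) + f v    ≡⟨ cong (_+ f v) (sum-remove g) ⟨
  sum g + f v                        ∎
  where
  open ≡-Reasoning
  rest : sum (f ∘ punchIn v) ≡ sum (g ∘ punchIn v)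
  rest = sum-cong-≗ λ i → f≡g (punchIn v i) (punchInᵢ≢i v i)
  swap-ends : ∀ a b c → a + b + c ≡ c + b + a
  swap-ends = solve-∀

am-gm-≤ : ∀ {a b} → a ≤ b → 4 * (a * b) ≤ (a + b) * (a + b)
am-gm-≤ {a} a≤b with m≤n⇒∃[o]m+o≡n a≤b
... | k , refl = subst (4 * (a * (a + k)) ≤_) (square-gap a k) (m≤m+n _ (k * k))
  where
  square-gap : ∀ a k → 4 * (a * (a + k)) + k * k ≡ (a + (a + k)) * (a + (a + k))
  square-gap = solve-∀

am-gm : ∀ a b → 4 * (a * b) ≤ (a + b) * (a + b)
am-gm a b with ≤-total a b
... | inj₁ a≤b = am-gm-≤ a≤b
... | inj₂ b≤a = subst₂ _≤_ (cong (4 *_) (*-comm b a)) (cong₂ _*_ (+-comm b a) (+-comm b a)) (am-gm-≤ b≤a)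

module Tournament {n : ℕ} (A : Digraph (suc n)) (tournament : IsTournament A) where
  open IsTournament tournament

  t : ℕ
  t = suc n

  arc : Fin t → Fin t → ℕ
  arc u v = ⟦ A u v ⟧

  outdeg indeg : Fin t → ℕ
  outdeg u = ∑[ v < t ] arc u v
  indeg v = ∑[ u < t ] arc u v

  arc-loop : ∀ v → arc v v ≡ 0
  arc-loop v = cong ⟦_⟧ (irreflexive v)

  arc-reverse : ∀ u v → u ≢ v → arc v u ≡ ⟦ not (A u v) ⟧
  arc-reverse u v u≢v = cong ⟦_⟧ (sym (orientation u v u≢v))

  arc-total : ∀ u v → u ≢ v → arc u v + arc v u ≡ 1
  arc-total u v u≢v = trans (cong (arc u v +_) (arc-reverse u v u≢v)) (⟦⟧+⟦not⟧ (A u v))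

  arc-antisym : ∀ u v → arc u v * arc v u ≡ 0
  arc-antisym u v with u ≟ᶠ v
  ... | yes refl = cong (_* arc u u) (arc-loop u)
  ... | no u≢v   = trans (cong (arc u v *_) (arc-reverse u v u≢v)) (⟦⟧*⟦not⟧ (A u v))

  split-by-arc : ∀ x {u v} → u ≢ v → x ≡ x * arc u v + x * arc v u
  split-by-arc x {u} {v} u≢v = begin
    x                           ≡⟨ *-identityʳ x ⟨
    x * 1                       ≡⟨ cong (x *_) (arc-total u v u≢v) ⟨
    x * (arc u v + arc v u)     ≡⟨ *-distribˡ-+ x (arc u v) (arc v u) ⟩
    x * arc u v + x * arc v u   ∎
    where open ≡-Reasoning

  outdeg+indeg : ∀ v → outdeg v + indeg v ≡ n
  outdeg+indeg v = +-cancelʳ-≡ 1 _ _ (begin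
    outdeg v + indeg v + 1                  ≡⟨ cong (_+ 1) (∑-distrib-+ (arc v) (λ u → arc u v)) ⟨
    ∑[ u < t ] (arc v u + arc u v) + 1      ≡⟨ sum-except v (λ u u≢v → arc-total v u (u≢v ∘ sym)) ⟩
    ∑[ u < t ] 1 + (arc v v + arc v v)      ≡⟨ cong₂ _+_ (sum-const t 1) (cong₂ _+_ (arc-loop v) (arc-loop v)) ⟩
    t * 1 + 0                               ≡⟨ trans (+-identityʳ _) (*-identityʳ t) ⟩
    1 + n                                   ≡⟨ +-comm 1 n ⟩
    n + 1                                   ∎)
    where open ≡-Reasoning

  arcCount : ℕ
  arcCount = ∑[ u < t ] outdeg u

  handshake : 2 * arcCount ≡ t * n
  handshake = begin
    2 * arcCount                                ≡⟨ cong (arcCount +_) (+-identityʳ arcCount) ⟩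
    arcCount + arcCount                         ≡⟨ cong (arcCount +_) (∑-comm arc) ⟩
    arcCount + ∑[ v < t ] indeg v               ≡⟨ ∑-distrib-+ outdeg indeg ⟨
    ∑[ v < t ] (outdeg v + indeg v)             ≡⟨ sum-cong-≗ outdeg+indeg ⟩
    ∑[ v < t ] n                                ≡⟨ sum-const t n ⟩
    t * n                                       ∎
    where open ≡-Reasoning

  cyclicTriplesVia transitiveTriplesVia : Fin t → ℕ
  cyclicTriplesVia v     = ∑[ u < t ] ∑[ w < t ] (arc u v * arc v w * arc w u)
  transitiveTriplesVia v = ∑[ u < t ] ∑[ w < t ] (arc u v * arc v w * arc u w)

  cyclicTriples transitiveTriples : ℕ
  cyclicTriples     = ∑[ u < t ] ∑[ v < t ] ∑[ w < t ] (arc u v * arc v w * arc w u)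
  transitiveTriples = ∑[ u < t ] ∑[ v < t ] ∑[ w < t ] (arc u v * arc v w * arc u w)

  two-path-closes : ∀ u v w →
    arc u v * arc v w ≡ arc u v * arc v w * arc w u + arc u v * arc v w * arc u w
  two-path-closes u v w with w ≟ᶠ u
  ... | yes refl rewrite arc-antisym w v = refl
  ... | no w≢u   = split-by-arc (arc u v * arc v w) w≢u

  indeg*outdeg : ∀ v → indeg v * outdeg v ≡ cyclicTriplesVia v + transitiveTriplesVia v
  indeg*outdeg v = begin
    indeg v * outdeg v                        ≡⟨ sum-*-sum (λ u → arc u v) (arc v) ⟩
    ∑[ u < t ] ∑[ w < t ] (arc u v * arc v w) ≡⟨ sum-cong-≗ (λ u → sum-cong-≗ (two-path-closes u v)) ⟩
    ∑[ u < t ] ∑[ w < t ] (arc u v * arc v w * arc w u + arc u v * arc v w * arc u w)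
      ≡⟨ ∑∑-distrib-+ (λ u w → arc u v * arc v w * arc w u) (λ u w → arc u v * arc v w * arc u w) ⟩
    cyclicTriplesVia v + transitiveTriplesVia v ∎
    where open ≡-Reasoning

  two-paths : ∑[ v < t ] (indeg v * outdeg v) ≡ cyclicTriples + transitiveTriples
  two-paths = begin
    ∑[ v < t ] (indeg v * outdeg v)
      ≡⟨ sum-cong-≗ indeg*outdeg ⟩
    ∑[ v < t ] (cyclicTriplesVia v + transitiveTriplesVia v)
      ≡⟨ ∑-distrib-+ cyclicTriplesVia transitiveTriplesVia ⟩
    ∑[ v < t ] cyclicTriplesVia v + ∑[ v < t ] transitiveTriplesVia v
      ≡⟨ cong₂ _+_ (∑-comm (λ v u → ∑[ w < t ] (arc u v * arc v w * arc w u)))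
                   (∑-comm (λ v u → ∑[ w < t ] (arc u v * arc v w * arc u w))) ⟩
    cyclicTriples + transitiveTriples
      ∎
    where open ≡-Reasoning

  row-split : ∀ (x : Fin t → ℕ) v → ∑[ w < t ] (x v * x w) ≡
    ∑[ w < t ] (x v * x w * arc v w) + ∑[ w < t ] (x v * x w * arc w v) + x v * x v
  row-split x v = begin
    ∑[ w < t ] (x v * x w)                       ≡⟨ +-identityʳ _ ⟨
    ∑[ w < t ] (x v * x w) + 0                   ≡⟨ cong (∑[ w < t ] (x v * x w) +_) diagonal ⟨
    ∑[ w < t ] (x v * x w) + (xvv * arc v v + xvv * arc v v)
      ≡⟨ sum-except v (λ w w≢v → split-by-arc (x v * x w) (w≢v ∘ sym)) ⟩
    ∑[ w < t ] (x v * x w * arc v w + x v * x w * arc w v) + xvv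
      ≡⟨ cong (_+ xvv) (∑-distrib-+ (λ w → x v * x w * arc v w) (λ w → x v * x w * arc w v)) ⟩
    ∑[ w < t ] (x v * x w * arc v w) + ∑[ w < t ] (x v * x w * arc w v) + xvv ∎
    where
    open ≡-Reasoning
    xvv = x v * x v
    diagonal : xvv * arc v v + xvv * arc v v ≡ 0
    diagonal rewrite arc-loop v | *-zeroʳ xvv = refl

  sum-square : ∀ (x : Fin t → ℕ) → sum x * sum x ≡
    2 * ∑[ v < t ] ∑[ w < t ] (x v * x w * arc v w) + ∑[ v < t ] (x v * x v)
  sum-square x = begin
    sum x * sum x                                 ≡⟨ sum-*-sum x x ⟩
    ∑[ v < t ] ∑[ w < t ] (x v * x w)             ≡⟨ sum-cong-≗ (row-split x) ⟩
    ∑[ v < t ] (L v + R v + x v * x v)            ≡⟨ ∑-distrib-+ (λ v → L v + R v) (λ v → x v * x v) ⟩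
    ∑[ v < t ] (L v + R v) + ∑[ v < t ] (x v * x v)
      ≡⟨ cong (_+ ∑[ v < t ] (x v * x v)) (∑-distrib-+ L R) ⟩
    sum L + sum R + ∑[ v < t ] (x v * x v)        ≡⟨ cong (λ r → sum L + r + ∑[ v < t ] (x v * x v)) R≡L ⟩
    sum L + sum L + ∑[ v < t ] (x v * x v)        ≡⟨ cong (λ l → sum L + l + ∑[ v < t ] (x v * x v)) (+-identityʳ (sum L)) ⟨
    2 * sum L + ∑[ v < t ] (x v * x v)            ∎
    where
    open ≡-Reasoning
    L R : Fin t → ℕ
    L v = ∑[ w < t ] (x v * x w * arc v w)
    R v = ∑[ w < t ] (x v * x w * arc w v)
    R≡L : sum R ≡ sum L
    R≡L = trans (∑-comm (λ v w → x v * x w * arc w v))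
                (sum-cong-≗ λ w → sum-cong-≗ λ v → cong (_* arc w v) (*-comm (x v) (x w)))

  outdeg-square : ∀ u → outdeg u * outdeg u ≡
    2 * ∑[ v < t ] ∑[ w < t ] (arc u v * arc v w * arc u w) + outdeg u
  outdeg-square u = trans (sum-square (arc u)) (cong₂ (λ T d → 2 * T + d)
    (sum-cong-≗ λ v → sum-cong-≗ λ w → xy∙z≈xz∙y (arc u v) (arc u w) (arc v w))
    (sum-cong-≗ λ v → ⟦⟧-idem (A u v)))

  sum-outdeg-square : ∑[ u < t ] (outdeg u * outdeg u) ≡ 2 * transitiveTriples + arcCount
  sum-outdeg-square = begin
    ∑[ u < t ] (outdeg u * outdeg u)            ≡⟨ sum-cong-≗ outdeg-square ⟩
    ∑[ u < t ] (2 * T u + outdeg u)             ≡⟨ ∑-distrib-+ (λ u → 2 * T u) outdeg ⟩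
    ∑[ u < t ] (2 * T u) + arcCount             ≡⟨ cong (_+ arcCount) (*-distribˡ-sum 2 T) ⟨
    2 * transitiveTriples + arcCount            ∎
    where
    open ≡-Reasoning
    T : Fin t → ℕ
    T u = ∑[ v < t ] ∑[ w < t ] (arc u v * arc v w * arc u w)

  sum-degree-products : ∑[ v < t ] (outdeg v * outdeg v) + ∑[ v < t ] (indeg v * outdeg v) ≡ n * arcCount
  sum-degree-products = begin
    ∑[ v < t ] (outdeg v * outdeg v) + ∑[ v < t ] (indeg v * outdeg v)
      ≡⟨ ∑-distrib-+ (λ v → outdeg v * outdeg v) (λ v → indeg v * outdeg v) ⟨
    ∑[ v < t ] (outdeg v * outdeg v + indeg v * outdeg v)
      ≡⟨ sum-cong-≗ (λ v → trans (sym (*-distribʳ-+ (outdeg v) (outdeg v) (indeg v)))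
                                 (cong (_* outdeg v) (outdeg+indeg v))) ⟩
    ∑[ v < t ] (n * outdeg v)
      ≡⟨ *-distribˡ-sum n outdeg ⟨
    n * arcCount ∎
    where open ≡-Reasoning

  sum-indeg*outdeg-≤ : 4 * ∑[ v < t ] (indeg v * outdeg v) ≤ t * (n * n)
  sum-indeg*outdeg-≤ = begin
    4 * ∑[ v < t ] (indeg v * outdeg v)               ≡⟨ *-distribˡ-sum 4 (λ v → indeg v * outdeg v) ⟩
    ∑[ v < t ] (4 * (indeg v * outdeg v))             ≤⟨ sum-mono-≤ (λ v → am-gm (indeg v) (outdeg v)) ⟩
    ∑[ v < t ] ((indeg v + outdeg v) * (indeg v + outdeg v))
      ≡⟨ sum-cong-≗ (λ v → cong (λ d → d * d) (trans (+-comm (indeg v) (outdeg v)) (outdeg+indeg v))) ⟩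
    ∑[ v < t ] (n * n)                                ≡⟨ sum-const t (n * n) ⟩
    t * (n * n)                                       ∎
    where open ≤-Reasoning

  -- 2 t n² is added to both sides so that no truncated subtraction is needed.
  cyclicTriples-≤ : 8 * cyclicTriples ≤ t * n * (n + 2)
  cyclicTriples-≤ = +-cancelʳ-≤ (2 * (t * n * n)) (8 * C) (t * n * (n + 2)) (begin
    8 * C + 2 * (t * n * n)                   ≡⟨ cong (λ m → 8 * C + 2 * (m * n)) handshake ⟨
    8 * C + 2 * (2 * S * n)                   ≡⟨ regroup₁ C S n ⟩
    4 * (2 * C + n * S)                       ≡⟨ cong (λ m → 4 * (2 * C + m)) sum-degree-products ⟨
    4 * (2 * C + (∑[ v < t ] (outdeg v * outdeg v) + ∑[ v < t ] (indeg v * outdeg v)))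
      ≡⟨ cong₂ (λ q p → 4 * (2 * C + (q + p))) sum-outdeg-square two-paths ⟩
    4 * (2 * C + (2 * T + S + (C + T)))       ≡⟨ regroup₂ C T S ⟩
    3 * (4 * (C + T)) + 2 * (2 * S)           ≡⟨ cong (λ p → 3 * (4 * p) + 2 * (2 * S)) two-paths ⟨
    3 * (4 * ∑[ v < t ] (indeg v * outdeg v)) + 2 * (2 * S)
      ≤⟨ +-monoˡ-≤ (2 * (2 * S)) (*-monoʳ-≤ 3 sum-indeg*outdeg-≤) ⟩
    3 * (t * (n * n)) + 2 * (2 * S)           ≡⟨ cong (λ m → 3 * (t * (n * n)) + 2 * m) handshake ⟩
    3 * (t * (n * n)) + 2 * (t * n)           ≡⟨ regroup₃ t n ⟩
    t * n * (n + 2) + 2 * (t * n * n)         ∎)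
    where
    open ≤-Reasoning
    C T S : ℕ
    C = cyclicTriples
    T = transitiveTriples
    S = arcCount
    regroup₁ : ∀ C S n → 8 * C + 2 * (2 * S * n) ≡ 4 * (2 * C + n * S)
    regroup₁ = solve-∀
    regroup₂ : ∀ C T S → 4 * (2 * C + (2 * T + S + (C + T))) ≡ 3 * (4 * (C + T)) + 2 * (2 * S)
    regroup₂ = solve-∀
    regroup₃ : ∀ t n → 3 * (t * (n * n)) + 2 * (t * n) ≡ t * n * (n + 2) + 2 * (t * n * n)
    regroup₃ = solve-∀

  cyclicTrianglesOn≡ : ∀ u v → cyclicTrianglesOn A u v ≡ ∑[ w < t ] (arc v w * arc w u)
  cyclicTrianglesOn≡ u v = trans (length-filter-tabulate (λ w → A v w ∧ A w u) id)
                                 (sum-cong-≗ λ w → ⟦∧⟧ (A v w) (A w u))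

  sum-over-arcs-cyclicTrianglesOn :
    ∑[ u < t ] ∑[ v < t ] (arc u v * cyclicTrianglesOn A u v) ≡ cyclicTriples
  sum-over-arcs-cyclicTrianglesOn = sum-cong-≗ λ u → sum-cong-≗ λ v → begin
    arc u v * cyclicTrianglesOn A u v           ≡⟨ cong (arc u v *_) (cyclicTrianglesOn≡ u v) ⟩
    arc u v * ∑[ w < t ] (arc v w * arc w u)    ≡⟨ *-distribˡ-sum (arc u v) (λ w → arc v w * arc w u) ⟩
    ∑[ w < t ] (arc u v * (arc v w * arc w u))  ≡⟨ sum-cong-≗ (λ w → *-assoc (arc u v) (arc v w) (arc w u)) ⟨
    ∑[ w < t ] (arc u v * arc v w * arc w u)    ∎
    where open ≡-Reasoning

  arc*-monoʳ-≤ : ∀ u v {a b} → (IsArc A u v → a ≤ b) → arc u v * a ≤ arc u v * b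
  arc*-monoʳ-≤ u v a≤b with A u v
  ... | true  = +-monoˡ-≤ 0 (a≤b refl)
  ... | false = z≤n

  all-arcs-heavy⇒ : ∀ k → (∀ u v → IsArc A u v → k ≤ 4 * cyclicTrianglesOn A u v) →
    arcCount * k ≤ 4 * cyclicTriples
  all-arcs-heavy⇒ k heavy = begin
    arcCount * k                                              ≡⟨ *-distribʳ-sum k outdeg ⟩
    ∑[ u < t ] (outdeg u * k)                                 ≡⟨ sum-cong-≗ (λ u → *-distribʳ-sum k (arc u)) ⟩
    ∑[ u < t ] ∑[ v < t ] (arc u v * k)
      ≤⟨ sum-mono-≤ (λ u → sum-mono-≤ λ v → arc*-monoʳ-≤ u v (heavy u v)) ⟩
    ∑[ u < t ] ∑[ v < t ] (arc u v * (4 * cyclicTrianglesOn A u v))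
      ≡⟨ sum-cong-≗ (λ u → sum-cong-≗ λ v → x∙yz≈y∙xz (arc u v) 4 (cyclicTrianglesOn A u v)) ⟩
    ∑[ u < t ] ∑[ v < t ] (4 * (arc u v * cyclicTrianglesOn A u v))
      ≡⟨ sum-cong-≗ (λ u → *-distribˡ-sum 4 (λ v → arc u v * cyclicTrianglesOn A u v)) ⟨
    ∑[ u < t ] (4 * ∑[ v < t ] (arc u v * cyclicTrianglesOn A u v))
      ≡⟨ *-distribˡ-sum 4 (λ u → ∑[ v < t ] (arc u v * cyclicTrianglesOn A u v)) ⟨
    4 * ∑[ u < t ] ∑[ v < t ] (arc u v * cyclicTrianglesOn A u v)
      ≡⟨ cong (4 *_) sum-over-arcs-cyclicTrianglesOn ⟩
    4 * cyclicTriples                                         ∎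
    where open ≤-Reasoning

  ¬all-arcs-heavy : .{{NonZero n}} →
    ¬ (∀ u v → IsArc A u v → t + 2 ≤ 4 * cyclicTrianglesOn A u v)
  ¬all-arcs-heavy heavy = 1+n≰n (+-cancelʳ-≤ 2 t n (*-cancelˡ-≤ (t * n) {{m*n≢0 t n}} (begin
    t * n * (t + 2)           ≡⟨ cong (_* (t + 2)) handshake ⟨
    2 * arcCount * (t + 2)    ≡⟨ *-assoc 2 arcCount (t + 2) ⟩
    2 * (arcCount * (t + 2))  ≤⟨ *-monoʳ-≤ 2 (all-arcs-heavy⇒ (t + 2) heavy) ⟩
    2 * (4 * cyclicTriples)   ≡⟨ *-assoc 2 4 cyclicTriples ⟨
    8 * cyclicTriples         ≤⟨ cyclicTriples-≤ ⟩
    t * n * (n + 2)           ∎)))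
    where open ≤-Reasoning

lemma2p2 : (t : ℕ) → 2 ≤ t → (A : Digraph t) → IsTournament A →
    ∃₂ λ (u v : Fin t) → IsArc A u v × (4 * cyclicTrianglesOn A u v ≤ t + 1)
lemma2p2 (suc (suc m)) (s≤s (s≤s z≤n)) A tournament
  with any? (λ u → any? λ v → (A u v ≟ᵇ true) ×-dec (4 * cyclicTrianglesOn A u v ≤? suc (suc m) + 1))
... | yes light = light
... | no ¬light = contradiction heavy (Tournament.¬all-arcs-heavy A tournament)
  where
  heavy : ∀ u v → IsArc A u v → suc (suc m) + 2 ≤ 4 * cyclicTrianglesOn A u v
  heavy u v uv = subst (_≤ 4 * cyclicTrianglesOn A u v) (sym (+-suc (suc (suc m)) 1))
                       (≰⇒> λ few → ¬light (u , v , uv , few))
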